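{- Let $T$ and $T'$ be unrooted (vertex and/or edge labeled) trees, let $\varphi$ be a largest weight common subtree embedding for unrooted trees (LaWeCSE$_{\mathrm u}$) from $T$ to $T'$, and let $u\in V(T)$ be an inner vertex of a topological path of $\varphi$, with neighbors $N(u)=\{u_1,\dots,u_k\}$. Then the domain of $\varphi$ intersects exactly two of the rooted subtrees $T^u_{u_1},\dots,T^u_{u_k}$.
   Context: All trees are finite. For a tree $T$ and $x\in V(T)$, $T^x$ denotes $T$ rooted at $x$, and for $y\in V(T)$, $T^x_y$ denotes the subtree of $T^x$ consisting of $y$ and its descendants (with respect to root $x$), rooted at $y$. Topological embedding: a rooted tree $S$ is topologically embeddable in a rooted tree $T$ if there is an injective $\psi:V(S)\to V(T)$ such that (i) if $b$ is a child of $a$ in $S$ then $\psi(b)$ is a descendant of $\psi(a)$, and (ii) for distinct children $b,c$ of $a$, the paths from $\psi(a)$ to $\psi(b)$ and from $\psi(a)$ to $\psi(c)$ have exactly $\psi(a)$ in common. A common subtree embedding (CSE) between rooted trees $T$, $T'$ is $\varphi=\psi'\circ\psi^{ -1}:\psi(V(S))\to V(T')$ where $S$ is a rooted tree topologically embeddable in $T$ via $\psi$ and in $T'$ via $\psi'$. For each edge $ab$ of $S$ ($b$ a child of $a$), the path in $T$ from $\psi(a)$ to $\psi(b)$ and the path in $T'$ from $\psi'(a)$ to $\psi'(b)$ are called topological paths; inner vertices of a path are those other than its two endpoints. Weights: labels from a finite set $\Sigma$ via $l,l'$; $\omega:\Sigma\times\Sigma\to\mathbb{R}\cup\{ -\infty\}$,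 $\omega(x,y)=\omega(l(x),l'(y))$; penalty $p\in\mathbb{R}^{\ge0}\cup\{\infty\}$. A pair of topological paths of lengths $k$ (in $T$) and $l$ (in $T'$) has weight $\omega(e_1,e_1')$ if $k=l=1$ (their single edges), and $-p(k+l-2)$ otherwise. $W(\varphi)$ is the sum of $\omega(x,\varphi(x))$ over mapped vertices plus all topological path weights. LaWeCSE$_{\mathrm u}$: a pair of roots $r\in V(T)$, $s\in V(T')$ together with a CSE $\varphi$ between $T^r$ and $T'^s$ such that no CSE $\varphi'$ between $T^{r'}$ and $T'^{s'}$ for any $r'\in V(T)$, $s'\in V(T')$ has $W(\varphi')>W(\varphi)$. -}

module Defs where

open import Level using (0ℓ)
open import Data.Nat using (ℕ; zero; suc; _<ᵇ_)
import Data.Nat as ℕ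
open import Data.Bool using (Bool; true; false; _∧_; if_then_else_)
open import Data.Fin using (Fin; toℕ)
open import Data.Fin.Properties using (_≟_)
open import Data.List using (List; []; _∷_)
open import Data.Bool.ListAction using (any)
open import Data.List.Base using (allFin)
open import Data.List.Membership.Propositional using (_∈_)
open import Data.List.Relation.Unary.Unique.Propositional using (Unique)
open import Data.Product using (Σ; ∃; _×_; _,_)
open import Data.Sum using (_⊎_)
open import Relation.Nullary using (¬_; Dec; yes; no)
open import Relation.Nullary.Decidable using (⌊_⌋)
open import Relation.Binary.PropositionalEquality using (_≡_; _≢_)
open import Relation.Binary.Structures using (IsTotalOrder)
open import Algebra.Structures using (IsCommutativeRing)
open import Function.Definitions using (Injective)

-- The real numbers, axiomatised as a complete ordered field
-- (any model is isomorphic to ℝ).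

record RealField : Set₁ where
  infixl 6 _+_
  infixl 7 _*_
  infix 4 _≤_
  field
    Carrier : Set
    _+_ _*_ : Carrier → Carrier → Carrier
    -_ : Carrier → Carrier
    0# 1# : Carrier
    _≤_ : Carrier → Carrier → Set
    isCommutativeRing : IsCommutativeRing _≡_ _+_ _*_ -_ 0# 1#
    0≢1 : 0# ≢ 1#
    *-inverse : ∀ x → x ≢ 0# → ∃ λ y → y * x ≡ 1#
    isTotalOrder : IsTotalOrder _≡_ _≤_
    +-mono-≤ : ∀ {x y} z → x ≤ y → x + z ≤ y + z
    *-nonneg : ∀ {x y} → 0# ≤ x → 0# ≤ y → 0# ≤ x * y
    sup : (P : Carrier → Set) → (∃ λ x → P x) →
          (∃ λ b → ∀ x → P x → x ≤ b) →
          ∃ λ s → (∀ x → P x → x ≤ s) ×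
                  (∀ b → (∀ x → P x → x ≤ b) → s ≤ b)

data Walk {n : ℕ} (adj : Fin n → Fin n → Bool) : Fin n → Fin n → List (Fin n) → Set where
  here : ∀ {x} → Walk adj x x (x ∷ [])
  step : ∀ {x y z ps} → adj x y ≡ true → Walk adj y z ps → Walk adj x z (x ∷ ps)

SimplePath : {n : ℕ} → (Fin n → Fin n → Bool) → Fin n → Fin n → List (Fin n) → Set
SimplePath adj x y ps = Walk adj x y ps × Unique ps

record Tree : Set where
  field
    n : ℕ
    adj : Fin n → Fin n → Bool
    irrefl : ∀ x → adj x x ≡ false
    sym : ∀ x y → adj x y ≡ adj y x
    connected : ∀ x y → ∃ λ ps → SimplePath adj x y ps
    acyclic : ∀ {x y ps qs} → SimplePath adj x y ps → SimplePath adj x y qs → ps ≡ qs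

open Tree public

V : Tree → Set
V T = Fin (n T)

Adj : (T : Tree) → V T → V T → Set
Adj T x y = adj T x y ≡ true

OnPath : (T : Tree) → V T → V T → V T → Set
OnPath T x y v = ∃ λ ps → SimplePath (adj T) x y ps × v ∈ ps

-- In T^r : y is a descendant of x (x lies on the path from r to y; includes y = x)
Desc : (T : Tree) (r x y : V T) → Set
Desc T r x y = OnPath T r y x

Child : (T : Tree) (r a b : V T) → Set
Child T r a b = Adj T a b × OnPath T r b a

reach : (T : Tree) → ℕ → V T → V T → Bool
reach T zero x y = ⌊ x ≟ y ⌋
reach T (suc k) x y = any (λ z → adj T x z ∧ reach T k z y) (allFin (n T))

-- distance = length of the shortest walk = length (number of edges)
-- of the unique path between x and y
dist : (T : Tree) → V T → V T → ℕ
dist T x y = go (n T) 0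
  where
  go : ℕ → ℕ → ℕ
  go zero k = k
  go (suc f) k = if reach T k x y then k else go f (suc k)

record LTree (σ : ℕ) : Set where
  field
    tree : Tree
    lab : V tree → Fin σ
    elab : V tree → V tree → Fin σ           -- edge labels (read on edges)
    elab-sym : ∀ x y → elab x y ≡ elab y x

open LTree public

record TopEmb (S : Tree) (a₀ : V S) (T : Tree) (r : V T) (ψ : V S → V T) : Set where
  field
    inj : Injective _≡_ _≡_ ψ
    childDesc : ∀ a b → Child S a₀ a b → Desc T r (ψ a) (ψ b)
    disjoint : ∀ a b c → Child S a₀ a b → Child S a₀ a c → b ≢ c →
               ∀ v → OnPath T (ψ a) (ψ b) v → OnPath T (ψ a) (ψ c) v → v ≡ ψ a

-- a CSE between T^r and T'^s: φ = ψ' ∘ ψ⁻¹ for a rooted tree (S, root)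
record CSE {σ : ℕ} (T T' : LTree σ) (r : V (tree T)) (s : V (tree T')) : Set where
  field
    S : Tree
    root : V S
    ψ : V S → V (tree T)
    ψ' : V S → V (tree T')
    emb : TopEmb S root (tree T) r ψ
    emb' : TopEmb S root (tree T') s ψ'

open CSE public

module Weights (R : RealField) where
  open RealField R

  data Ext : Set where
    -∞ : Ext
    fin : Carrier → Ext

  _⊕_ : Ext → Ext → Ext
  -∞ ⊕ y = -∞
  fin x ⊕ -∞ = -∞
  fin x ⊕ fin y = fin (x + y)

  data _≤ₑ_ : Ext → Ext → Set where
    -∞≤ : ∀ {y} → -∞ ≤ₑ y
    fin≤ : ∀ {x y} → x ≤ y → fin x ≤ₑ fin y

  _<ₑ_ : Ext → Ext → Set
  x <ₑ y = x ≤ₑ y × ¬ (y ≤ₑ x)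

  data Penalty : Set where
    ∞ₚ : Penalty
    finₚ : (p : Carrier) → 0# ≤ p → Penalty

  _×ℕ_ : ℕ → Carrier → Carrier
  zero ×ℕ x = 0#
  suc m ×ℕ x = x + (m ×ℕ x)

  negPen : Penalty → ℕ → Ext
  negPen ∞ₚ m = -∞
  negPen (finₚ p _) m = fin (- (m ×ℕ p))

  -- weight of a pair of topological paths of lengths k and l,
  -- e = ω(e₁,e₁') used when k = l = 1
  pairW : Penalty → ℕ → ℕ → Ext → Ext
  pairW p (suc zero) (suc zero) e = e
  pairW p k l e = negPen p ((k ℕ.+ l) ℕ.∸ 2)

  sumF : {m : ℕ} → (Fin m → Ext) → Ext
  sumF {zero} f = fin 0#
  sumF {suc m} f = f Fin.zero ⊕ sumF (λ i → f (Fin.suc i))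
    where import Data.Fin as Fin

  module _ {σ : ℕ} (ω : Fin σ → Fin σ → Ext) (p : Penalty) where

    -- W(φ): vertex weights plus weights of all pairs of topological paths
    -- (one per edge ab of S, each edge counted once via toℕ a < toℕ b)
    W : {T T' : LTree σ} {r : V (tree T)} {s : V (tree T')} → CSE T T' r s → Ext
    W {T} {T'} φ = sumF (λ a → ω (lab T (ψ φ a)) (lab T' (ψ' φ a)))
                 ⊕ sumF (λ a → sumF (λ b →
                     if adj (S φ) a b ∧ (toℕ a <ᵇ toℕ b)
                     then pairW p (dist (tree T) (ψ φ a) (ψ φ b))
                                  (dist (tree T') (ψ' φ a) (ψ' φ b))
                                  (ω (elab T (ψ φ a) (ψ φ b)) (elab T' (ψ' φ a) (ψ' φ b)))
                     else fin 0#))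

    IsLaWeCSEu : {T T' : LTree σ} {r : V (tree T)} {s : V (tree T')} → CSE T T' r s → Set
    IsLaWeCSEu {T} {T'} φ = ∀ (r' : V (tree T)) (s' : V (tree T')) (φ' : CSE T T' r' s') →
                            ¬ (W φ <ₑ W φ')

InnerVertex : {σ : ℕ} {T T' : LTree σ} {r : V (tree T)} {s : V (tree T')} →
              CSE T T' r s → V (tree T) → Set
InnerVertex {T = T} φ u =
  ∃ λ a → ∃ λ b → Child (S φ) (root φ) a b ×
    OnPath (tree T) (ψ φ a) (ψ φ b) u × u ≢ ψ φ a × u ≢ ψ φ b

Hits : {σ : ℕ} {T T' : LTree σ} {r : V (tree T)} {s : V (tree T')} →
       CSE T T' r s → V (tree T) → V (tree T) → Set
Hits {T = T} φ u w = ∃ λ a → Desc (tree T) u w (ψ φ a)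

ExactlyTwo : {σ : ℕ} {T T' : LTree σ} {r : V (tree T)} {s : V (tree T')} →
             CSE T T' r s → V (tree T) → Set
ExactlyTwo {T = T} φ u =
  Σ (V (tree T)) λ w₁ → Σ (V (tree T)) λ w₂ →
    Adj (tree T) u w₁ × Adj (tree T) u w₂ × w₁ ≢ w₂ ×
    Hits φ u w₁ × Hits φ u w₂ ×
    (∀ w → Adj (tree T) u w → Hits φ u w → w ≡ w₁ ⊎ w ≡ w₂)

-- Root T at r. The topological path of φ from ψ a down to ψ b (b a child of a in S) passes
-- through u, so u has a parent w₁, whose branch contains ψ a, and a child w₂ towards ψ b, whose
-- branch contains ψ b. Every other branch at u lies below u and avoids w₂. It contains no image
-- vertex: going down the chain of S from its root to any z with ψ z below u, the first
-- topological path to reach u starts at some d with ψ d strictly above u. If d = a, the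
-- disjointness of the paths leaving ψ a forces that edge to be a → b; otherwise ψ d or ψ a would
-- be an image vertex strictly inside a topological path, which never happens.
module Submission where

open import Defs
open import Data.Nat using (ℕ)
open import Data.Fin using (Fin)

open import Level using (0ℓ)
open import Data.Bool using (Bool; true)
open import Data.Empty using (⊥; ⊥-elim)
open import Data.Fin.Properties using (_≟_)
open import Data.Nat using (suc; _+_; _<_; _≤_; s≤s)
open import Data.Nat.Properties using (m≤n+m; n≤1+n; ≤-pred; ≤-refl; ≤-reflexive; ≤-trans; <⇒≱)
open import Data.List using (List; []; _∷_; _++_; _∷ʳ_; [_]; length; reverse; initLast; _∷ʳ′_)
open import Data.List.Properties using (++-assoc; length-++; ∷ʳ-++; ∷ʳ-injectiveˡ; ∷-injectiveˡ; ∷-injectiveʳ; unfold-reverse)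
open import Data.List.Membership.Propositional using (_∈_)
open import Data.List.Membership.Propositional.Properties using (∈-++⁺ˡ; ∈-++⁺ʳ; ∈-++⁻; ∈-∃++)
open import Data.List.Relation.Unary.Any using (here; there; any?)
import Data.List.Relation.Unary.Any.Properties as Anyₚ
open import Data.List.Relation.Unary.All using ([]; _∷_)
import Data.List.Relation.Unary.All.Properties as Allₚ
open import Data.List.Relation.Unary.AllPairs using (_∷_)
open import Data.List.Relation.Unary.Unique.Propositional using (Unique; [])
open import Data.List.Relation.Unary.Unique.Propositional.Properties using (++⁺)
open import Data.List.Relation.Unary.Unique.Setoid.Properties using (Unique[x∷xs]⇒x∉xs)
open import Data.List.Relation.Binary.Disjoint.Propositional using (Disjoint)
open import Data.List.Relation.Binary.Permutation.Setoid using (↭-sym)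
open import Data.List.Relation.Binary.Permutation.Setoid.Properties using (Unique-resp-↭; ↭-reverse)
open import Data.Product using (∃; ∃₂; _×_; _,_; proj₁; proj₂; map₁)
open import Data.Sum using (_⊎_; inj₁; inj₂)
open import Function using (_∘_)
open import Induction.WellFounded using (WellFounded; module Subrelation; module All)
import Relation.Binary.Construct.On as On
open import Data.Nat.Induction using (<-wellFounded)
open import Relation.Nullary using (¬_; yes; no)
open import Relation.Binary.PropositionalEquality using (_≡_; _≢_; refl; trans; cong; subst; setoid)
import Relation.Binary.PropositionalEquality as ≡

module _ {A : Set} where

  Unique-++⁻ˡ : ∀ xs {ys : List A} → Unique (xs ++ ys) → Unique xs
  Unique-++⁻ˡ []       _        = []
  Unique-++⁻ˡ (_ ∷ xs) (px ∷ u) = Allₚ.++⁻ˡ xs px ∷ Unique-++⁻ˡ xs u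

  Unique-++⁻ʳ : ∀ xs {ys : List A} → Unique (xs ++ ys) → Unique ys
  Unique-++⁻ʳ []       u       = u
  Unique-++⁻ʳ (_ ∷ xs) (_ ∷ u) = Unique-++⁻ʳ xs u

  Unique-reverse : ∀ {xs : List A} → Unique xs → Unique (reverse xs)
  Unique-reverse {xs} = Unique-resp-↭ (setoid A) (↭-sym (setoid A) (↭-reverse (setoid A) xs))

  suffixes-comparable : ∀ (xs ys : List A) {us vs} → xs ++ us ≡ ys ++ vs →
                        (∃ λ zs → us ≡ zs ++ vs) ⊎ (∃ λ zs → vs ≡ zs ++ us)
  suffixes-comparable []       ys       eq = inj₁ (ys , eq)
  suffixes-comparable (x ∷ xs) []       eq = inj₂ (x ∷ xs , ≡.sym eq)
  suffixes-comparable (x ∷ xs) (y ∷ ys) eq = suffixes-comparable xs ys (∷-injectiveʳ eq)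

module Walks {m : ℕ} (A : Fin m → Fin m → Bool) where

  walk-head : ∀ {x y ps} → Walk A x y ps → ∃ λ t → ps ≡ x ∷ t
  walk-head here       = _ , refl
  walk-head (step _ _) = _ , refl

  walk-last-∈ : ∀ {x y ps} → Walk A x y ps → y ∈ ps
  walk-last-∈ here       = here refl
  walk-last-∈ (step _ w) = there (walk-last-∈ w)

  walk-trivial : ∀ {x y} → Walk A x y [ x ] → x ≡ y
  walk-trivial here = refl

  walk-first-edge : ∀ {x y z w t} → Walk A x y (z ∷ w ∷ t) → A x w ≡ true
  walk-first-edge (step e here)       = e
  walk-first-edge (step e (step _ _)) = e

  walk-∷ʳ : ∀ {x y z ps} → Walk A x y ps → A y z ≡ true → Walk A x z (ps ∷ʳ z)
  walk-∷ʳ here       e = step e here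
  walk-∷ʳ (step e′ w) e = step e′ (walk-∷ʳ w e)

  walk-++ : ∀ {x y z ps qs} → Walk A x y ps → Walk A y z (y ∷ qs) → Walk A x z (ps ++ qs)
  walk-++ here       w' = w'
  walk-++ (step e w) w' = step e (walk-++ w w')

  walk-reverse : (∀ x y → A x y ≡ A y x) → ∀ {x y ps} → Walk A x y ps → Walk A y x (reverse ps)
  walk-reverse A-sym here = here
  walk-reverse A-sym (step {x} {y} {ps = ps} e w) =
    subst (Walk A _ x) (≡.sym (unfold-reverse x ps)) (walk-∷ʳ (walk-reverse A-sym w) (trans (A-sym y x) e))

  walk-split : ∀ pre {x y v post} → Walk A x y (pre ++ v ∷ post) →
               Walk A x v (pre ∷ʳ v) × Walk A v y (v ∷ post)
  walk-split []            here       = here , here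
  walk-split []            (step e w) = here , step e w
  walk-split (_ ∷ [])      (step e w) = map₁ (step e) (walk-split [] w)
  walk-split (_ ∷ p ∷ pre) (step e w) = map₁ (step e) (walk-split (p ∷ pre) w)

module Paths (T : Tree) where
  open Walks (adj T) public

  Path : V T → V T → List (V T) → Set
  Path = SimplePath (adj T)

  Adj-sym : ∀ {x y} → Adj T x y → Adj T y x
  Adj-sym {x} {y} e = trans (Tree.sym T y x) e

  Adj⇒≢ : ∀ {x y} → Adj T x y → x ≢ y
  Adj⇒≢ {x} e refl with trans (≡.sym e) (irrefl T x)
  ... | ()

  edge-path : ∀ {x y} → Adj T x y → Path x y (x ∷ y ∷ [])
  edge-path e = step e here , (Adj⇒≢ e ∷ []) ∷ [] ∷ []

  path-reverse : ∀ {x y ps} → Path x y ps → Path y x (reverse ps)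
  path-reverse (w , u) = walk-reverse (Tree.sym T) w , Unique-reverse u

  path-split : ∀ pre {x y v post} → Path x y (pre ++ v ∷ post) →
               Path x v (pre ∷ʳ v) × Path v y (v ∷ post)
  path-split pre {v = v} {post} (w , u) with walk-split pre w
  ... | to-v , from-v =
    (to-v , Unique-++⁻ˡ (pre ∷ʳ v) (subst Unique (≡.sym (∷ʳ-++ pre v post)) u)) ,
    (from-v , Unique-++⁻ʳ pre u)

  OnPath-sym : ∀ {x y v} → OnPath T x y v → OnPath T y x v
  OnPath-sym (ps , p , v∈ps) = reverse ps , path-reverse p , Anyₚ.reverse⁺ v∈ps

module Rooted (T : Tree) (r : V T) where
  open Paths T

  rootPath : V T → List (V T)
  rootPath x = proj₁ (connected T x r)

  rootPath-path : ∀ x → Path x r (rootPath x)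
  rootPath-path x = proj₂ (connected T x r)

  rootPath-unique : ∀ {x ps} → Path x r ps → ps ≡ rootPath x
  rootPath-unique p = acyclic T p (rootPath-path _)

  rootPath-head : ∀ x → ∃ λ t → rootPath x ≡ x ∷ t
  rootPath-head x = walk-head (proj₁ (rootPath-path x))

  x∈rootPath : ∀ x → x ∈ rootPath x
  x∈rootPath x = subst (x ∈_) (≡.sym (proj₂ (rootPath-head x))) (here refl)

  rootPath-injective : ∀ {x y} → rootPath x ≡ rootPath y → x ≡ y
  rootPath-injective {x} {y} eq with rootPath-head x | rootPath-head y
  ... | _ , ex | _ , ey = ∷-injectiveˡ (trans (≡.sym ex) (trans eq ey))

  rootPath-split : ∀ pre {y v rest} → rootPath y ≡ pre ++ v ∷ rest →
                   Path y v (pre ∷ʳ v) × rootPath v ≡ v ∷ rest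
  rootPath-split pre {y} eq with path-split pre (subst (Path y r) eq (rootPath-path y))
  ... | to-v , from-v = to-v , ≡.sym (rootPath-unique from-v)

  depth : V T → ℕ
  depth x = length (rootPath x)

  infix 4 _≼_ _≺_ _⋖_

  _≼_ : V T → V T → Set
  x ≼ y = ∃ λ pre → rootPath y ≡ pre ++ rootPath x

  _≺_ : V T → V T → Set
  x ≺ y = x ≼ y × x ≢ y

  _⋖_ : V T → V T → Set
  p ⋖ c = rootPath c ≡ c ∷ rootPath p

  ≼-refl : ∀ {x} → x ≼ x
  ≼-refl = [] , refl

  ≼-trans : ∀ {x y z} → x ≼ y → y ≼ z → x ≼ z
  ≼-trans {x} (p , y≡px) (q , z≡qy) =
    q ++ p , trans z≡qy (trans (cong (q ++_) y≡px) (≡.sym (++-assoc q p (rootPath x))))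

  ∈⇒≼ : ∀ {v y} → v ∈ rootPath y → v ≼ y
  ∈⇒≼ v∈ with ∈-∃++ v∈
  ... | ys , zs , eq = ys , trans eq (cong (ys ++_) (≡.sym (proj₂ (rootPath-split ys eq))))

  ≼⇒∈ : ∀ {v y} → v ≼ y → v ∈ rootPath y
  ≼⇒∈ {v} (pre , eq) = subst (v ∈_) (≡.sym eq) (∈-++⁺ʳ pre (x∈rootPath v))

  root-≼ : ∀ x → r ≼ x
  root-≼ x = ∈⇒≼ (walk-last-∈ (proj₁ (rootPath-path x)))

  ≼-comparable : ∀ {x y z} → x ≼ z → y ≼ z → x ≼ y ⊎ y ≼ x
  ≼-comparable (p , z≡px) (q , z≡qy) with suffixes-comparable p q (trans (≡.sym z≡px) z≡qy)
  ... | inj₁ y≼x = inj₂ y≼x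
  ... | inj₂ x≼y = inj₁ x≼y

  ≼⇒≡⊎depth< : ∀ {x y} → x ≼ y → x ≡ y ⊎ depth x < depth y
  ≼⇒≡⊎depth< ([] , eq) = inj₁ (rootPath-injective (≡.sym eq))
  ≼⇒≡⊎depth< {x} {y} (q ∷ pre , eq) = inj₂ (≤-trans (s≤s (m≤n+m _ _)) (≤-reflexive depth-y))
    where
    depth-y : suc (length pre + depth x) ≡ depth y
    depth-y = ≡.sym (trans (cong length eq) (cong suc (length-++ pre)))

  ≼-depth : ∀ {x y} → x ≼ y → depth x ≤ depth y
  ≼-depth x≼y with ≼⇒≡⊎depth< x≼y
  ... | inj₁ refl = ≤-refl
  ... | inj₂ x<y  = ≤-trans (n≤1+n _) x<y

  ≼∧depth≥⇒≡ : ∀ {x y} → x ≼ y → depth y ≤ depth x → x ≡ y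
  ≼∧depth≥⇒≡ x≼y y≤x with ≼⇒≡⊎depth< x≼y
  ... | inj₁ x≡y = x≡y
  ... | inj₂ x<y = ⊥-elim (<⇒≱ x<y y≤x)

  ≼-antisym : ∀ {x y} → x ≼ y → y ≼ x → x ≡ y
  ≼-antisym x≼y y≼x = ≼∧depth≥⇒≡ x≼y (≼-depth y≼x)

  ≺⇒depth< : ∀ {x y} → x ≺ y → depth x < depth y
  ≺⇒depth< (x≼y , x≢y) with ≼⇒≡⊎depth< x≼y
  ... | inj₁ x≡y = ⊥-elim (x≢y x≡y)
  ... | inj₂ x<y = x<y

  ≺-wellFounded : WellFounded _≺_
  ≺-wellFounded = Subrelation.wellFounded ≺⇒depth< (On.wellFounded depth <-wellFounded)

  ≼-≺-trans : ∀ {x y z} → x ≼ y → y ≺ z → x ≺ z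
  ≼-≺-trans x≼y (y≼z , y≢z) =
    ≼-trans x≼y y≼z , λ { refl → y≢z (≼-antisym y≼z x≼y) }

  ≺-≼-trans : ∀ {x y z} → x ≺ y → y ≼ z → x ≺ z
  ≺-≼-trans (x≼y , x≢y) y≼z =
    ≼-trans x≼y y≼z , λ { refl → x≢y (≼-antisym x≼y y≼z) }

  ⋖⇒≼ : ∀ {p c} → p ⋖ c → p ≼ c
  ⋖⇒≼ {c = c} eq = [ c ] , eq

  ⋖⇒depth≡ : ∀ {p c} → p ⋖ c → depth c ≡ suc (depth p)
  ⋖⇒depth≡ eq = cong length eq

  ⋖⇒Adj : ∀ {p c} → p ⋖ c → Adj T p c
  ⋖⇒Adj {p} {c} eq with rootPath-head p
  ... | t , ep = Adj-sym (walk-first-edge (subst (Walk (adj T) c r) c∷p∷t (proj₁ (rootPath-path c))))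
    where
    c∷p∷t : rootPath c ≡ c ∷ p ∷ t
    c∷p∷t = trans eq (cong (c ∷_) ep)

  ⋖⇒≺ : ∀ {p c} → p ⋖ c → p ≺ c
  ⋖⇒≺ p⋖c = ⋖⇒≼ p⋖c , Adj⇒≢ (⋖⇒Adj p⋖c)

  ⋖-unique-parent : ∀ {p q c} → p ⋖ c → q ⋖ c → p ≡ q
  ⋖-unique-parent p⋖c q⋖c = rootPath-injective (∷-injectiveʳ (trans (≡.sym p⋖c) q⋖c))

  ⋖-unique-child : ∀ {p c d x} → p ⋖ c → p ⋖ d → c ≼ x → d ≼ x → c ≡ d
  ⋖-unique-child p⋖c p⋖d c≼x d≼x with ≼-comparable c≼x d≼x
  ... | inj₁ c≼d = ≼∧depth≥⇒≡ c≼d (≤-reflexive (trans (⋖⇒depth≡ p⋖d) (≡.sym (⋖⇒depth≡ p⋖c))))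
  ... | inj₂ d≼c = ≡.sym (≼∧depth≥⇒≡ d≼c (≤-reflexive (trans (⋖⇒depth≡ p⋖c) (≡.sym (⋖⇒depth≡ p⋖d)))))

  rootPath-[] : ∀ {x} → rootPath x ≡ [ x ] → x ≡ r
  rootPath-[] {x} eq = walk-trivial (subst (Walk (adj T) x r) eq (proj₁ (rootPath-path x)))

  rootPath-∷ : ∀ {x p t} → rootPath x ≡ x ∷ p ∷ t → p ⋖ x × rootPath p ≡ p ∷ t
  rootPath-∷ {x} {p} {t} eq = trans eq (cong (x ∷_) (≡.sym p-path)) , p-path
    where
    p-path : rootPath p ≡ p ∷ t
    p-path = proj₂ (rootPath-split [ x ] eq)

  root-or-child : ∀ x → x ≡ r ⊎ ∃ (_⋖ x)
  root-or-child x with rootPath-head x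
  ... | []    , eq = inj₁ (rootPath-[] eq)
  ... | _ ∷ _ , eq = inj₂ (_ , proj₁ (rootPath-∷ eq))

  ≺-child : ∀ {x y} → x ≺ y → ∃ λ c → x ⋖ c × c ≼ y
  ≺-child {x} {y} ((pre , eq) , x≢y) with initLast pre
  ... | [] = ⊥-elim (x≢y (rootPath-injective (≡.sym eq)))
  ... | ini ∷ʳ′ c = c , c-path , ini , trans eq′ (cong (ini ++_) (≡.sym c-path))
    where
    eq′ : rootPath y ≡ ini ++ c ∷ rootPath x
    eq′ = trans eq (∷ʳ-++ ini c (rootPath x))

    c-path : x ⋖ c
    c-path = proj₂ (rootPath-split ini eq′)

  ≺-parent : ∀ {x y} → x ≺ y → ∃ λ p → p ⋖ y × x ≼ p
  ≺-parent {x} {y} x≺y with root-or-child y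
  ... | inj₁ refl = ⊥-elim (proj₂ x≺y (≼-antisym (proj₁ x≺y) (root-≼ x)))
  ... | inj₂ (p , p⋖y) with ≼-comparable (proj₁ x≺y) (⋖⇒≼ p⋖y)
  ...   | inj₁ x≼p = p , p⋖y , x≼p
  ...   | inj₂ p≼x = p , p⋖y , subst (_≼ p) (≼∧depth≥⇒≡ p≼x x≤p) ≼-refl
    where
    x≤p : depth x ≤ depth p
    x≤p = ≤-pred (subst (depth x <_) (⋖⇒depth≡ p⋖y) (≺⇒depth< x≺y))

  Adj⇒⋖ : ∀ {u w} → Adj T u w → w ⋖ u ⊎ u ⋖ w
  Adj⇒⋖ {u} {w} e with any? (w ≟_) (rootPath u)
  ... | no w∉ = inj₂ (≡.sym (rootPath-unique (step (Adj-sym e) (proj₁ (rootPath-path u)) ,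
                                              Allₚ.¬Any⇒All¬ _ w∉ ∷ proj₂ (rootPath-path u))))
  ... | yes w∈ with ∈-∃++ w∈
  ...   | ys , zs , eq with ∷ʳ-injectiveˡ ys [ u ] (acyclic T (proj₁ (rootPath-split ys eq)) (edge-path e))
  ...     | refl = inj₁ (proj₁ (rootPath-∷ eq))

  ≼-path : ∀ pre {x y} → rootPath y ≡ pre ++ rootPath x → Path y x (pre ∷ʳ x)
  ≼-path pre {x} eq with rootPath-head x
  ... | _ , ex = proj₁ (rootPath-split pre (trans eq (cong (pre ++_) ex)))

  ≼-onPath : ∀ {x v y} → x ≼ v → v ≼ y → OnPath T x y v
  ≼-onPath {x} {v} x≼v v≼y with ≼-trans x≼v v≼y
  ... | pre , eq = OnPath-sym (pre ∷ʳ x , ≼-path pre eq , v∈)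
    where
    v∈ : v ∈ pre ∷ʳ x
    v∈ with ∈-++⁻ pre (subst (v ∈_) eq (≼⇒∈ v≼y))
    ... | inj₁ v∈pre = ∈-++⁺ˡ v∈pre
    ... | inj₂ v∈x with ≼-antisym x≼v (∈⇒≼ v∈x)
    ...   | refl = ∈-++⁺ʳ pre (here refl)

  onPath-≼ : ∀ {x v y} → x ≼ y → OnPath T x y v → x ≼ v × v ≼ y
  onPath-≼ {x} {v} {y} (pre , eq) x⋯v⋯y with OnPath-sym x⋯v⋯y
  ... | ps , p , v∈ps with acyclic T p (≼-path pre eq)
  ... | refl with ∈-++⁻ pre v∈ps
  ... | inj₂ (here refl) = ≼-refl , pre , eq
  ... | inj₁ v∈pre = x≼v , ∈⇒≼ (subst (v ∈_) (≡.sym eq) (∈-++⁺ˡ v∈pre))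
    where
    x≼v : x ≼ v
    x≼v with ∈-∃++ v∈pre
    ... | ys , zs , refl = v ∷ zs , proj₂ (rootPath-split ys (trans eq (++-assoc ys (v ∷ zs) (rootPath x))))

  Desc⇒≼ : ∀ {x y} → Desc T r x y → x ≼ y
  Desc⇒≼ {y = y} d = proj₂ (onPath-≼ (root-≼ y) d)

  ⋖⇒Child : ∀ {p c} → p ⋖ c → Child T r p c
  ⋖⇒Child {p} p⋖c = ⋖⇒Adj p⋖c , ≼-onPath (root-≼ p) (⋖⇒≼ p⋖c)

  Child-induction : (P : V T → Set) → P r → (∀ {p c} → Child T r p c → P p → P c) → ∀ x → P x
  Child-induction P P-root P-step x = go (proj₂ (rootPath-head x))
    where
    go : ∀ {x t} → rootPath x ≡ x ∷ t → P x
    go {t = []}    eq = subst P (≡.sym (rootPath-[] eq)) P-root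
    go {t = _ ∷ _} eq = P-step (⋖⇒Child (proj₁ (rootPath-∷ eq))) (go (proj₂ (rootPath-∷ eq)))

  -- The path u ∷ w ∷ zs continues below w: reversing w ∷ zs and following rootPath w is a
  -- path from x to r, simple because a vertex of zs on rootPath u would put w above u.
  ⋖-onPath : ∀ {u w x} → u ⋖ w → OnPath T u x w → w ≼ x
  ⋖-onPath {u} {w} {x} u⋖w (qs , p , w∈qs) with ∈-∃++ w∈qs
  ... | ys , zs , refl with ∷ʳ-injectiveˡ ys [ u ] (acyclic T (proj₁ (path-split ys p)) (edge-path (⋖⇒Adj u⋖w)))
  ... | refl = reverse zs , ≡.sym (rootPath-unique (subst (Walk (adj T) x r) list-eq walk , unique))
    where
    w-to-x : Path w x (w ∷ zs)
    w-to-x = proj₂ (path-split [ u ] p)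

    walk : Walk (adj T) x r (reverse (w ∷ zs) ++ rootPath u)
    walk = walk-++ (proj₁ (path-reverse w-to-x)) (subst (Walk (adj T) w r) u⋖w (proj₁ (rootPath-path w)))

    list-eq : reverse (w ∷ zs) ++ rootPath u ≡ reverse zs ++ rootPath w
    list-eq = begin
      reverse (w ∷ zs) ++ rootPath u  ≡⟨ cong (_++ rootPath u) (unfold-reverse w zs) ⟩
      (reverse zs ∷ʳ w) ++ rootPath u ≡⟨ ∷ʳ-++ (reverse zs) w (rootPath u) ⟩
      reverse zs ++ w ∷ rootPath u    ≡⟨ cong (reverse zs ++_) u⋖w ⟨
      reverse zs ++ rootPath w        ∎
      where open ≡.≡-Reasoning

    u-to-t-via-w : ∀ {t} → t ∈ zs → OnPath T u t w
    u-to-t-via-w t∈zs with ∈-∃++ t∈zs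
    ... | q₁ , q₂ , zs≡q₁tq₂ =
      _ , proj₁ (path-split (u ∷ w ∷ q₁) (subst (Path u x) (cong (λ l → u ∷ w ∷ l) zs≡q₁tq₂) p)) , there (here refl)

    disjoint : Disjoint (reverse zs) (rootPath w)
    disjoint (t∈rzs , t∈w) with Anyₚ.reverse⁻ t∈rzs | subst (_ ∈_) u⋖w t∈w
    ... | w∈zs | here refl = Unique[x∷xs]⇒x∉xs (setoid (V T)) (proj₂ w-to-x) w∈zs
    ... | t∈zs | there t∈u =
      proj₂ (⋖⇒≺ u⋖w) (≼-antisym (⋖⇒≼ u⋖w) (proj₂ (onPath-≼ (∈⇒≼ t∈u) (OnPath-sym (u-to-t-via-w t∈zs)))))

    unique : Unique (reverse zs ++ rootPath w)
    unique = ++⁺ (Unique-reverse (Unique-++⁻ʳ [ w ] (proj₂ w-to-x))) (proj₂ (rootPath-path w)) disjoint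

module Embedding {T S : Tree} {r : V T} {root : V S} {ψ : V S → V T}
                 (emb : TopEmb S root T r ψ) where
  open TopEmb emb
  open Rooted T r
  open Rooted S root using () renaming
    (root-or-child to root-or-childˢ; ⋖⇒Child to ⋖⇒Childˢ; Child-induction to Child-inductionˢ)

  child-≺ : ∀ {a b} → Child S root a b → ψ a ≺ ψ b
  child-≺ {a} {b} a→b = Desc⇒≼ (childDesc a b a→b) , λ ψa≡ψb → Paths.Adj⇒≢ S (proj₁ a→b) (inj ψa≡ψb)

  root-≼-image : ∀ z → ψ root ≼ ψ z
  root-≼-image = Child-inductionˢ (λ z → ψ root ≼ ψ z) ≼-refl (λ a→b ih → ≼-trans ih (proj₁ (child-≺ a→b)))

  branch-unique : ∀ {a b e v} → Child S root a b → Child S root a e →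
                  ψ a ≺ v → v ≼ ψ b → v ≼ ψ e → b ≡ e
  branch-unique {a} {b} {e} {v} a→b a→e (ψa≼v , ψa≢v) v≼ψb v≼ψe with b ≟ e
  ... | yes b≡e = b≡e
  ... | no b≢e = ⊥-elim (ψa≢v (≡.sym (disjoint a b e a→b a→e b≢e v (≼-onPath ψa≼v v≼ψb) (≼-onPath ψa≼v v≼ψe))))

  InsideTopologicalPath : V T → Set
  InsideTopologicalPath v = ∃₂ λ a b → Child S root a b × ψ a ≺ v × v ≺ ψ b

  -- Induction on the depth of ψ z: if z has parent d, then ψ d or ψ a would lie strictly
  -- inside a shallower topological path, unless d = a, where z = b by disjointness.
  image-not-inside : ∀ z → ¬ InsideTopologicalPath (ψ z)
  image-not-inside = All.wfRec (On.wellFounded ψ ≺-wellFounded) 0ℓ (λ z → ¬ InsideTopologicalPath (ψ z)) below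
    where
    below : ∀ z → (∀ {z′} → ψ z′ ≺ ψ z → ¬ InsideTopologicalPath (ψ z′)) → ¬ InsideTopologicalPath (ψ z)
    below z ih (a , b , a→b , ψa≺ψz , ψz≺ψb) with root-or-childˢ z
    ... | inj₁ refl = proj₂ ψa≺ψz (≼-antisym (proj₁ ψa≺ψz) (root-≼-image a))
    ... | inj₂ (_ , d⋖z) = via-parent (⋖⇒Childˢ d⋖z)
      where
      via-parent : ∀ {d} → Child S root d z → ⊥
      via-parent {d} d→z with ψ d ≟ ψ a | ≼-comparable (proj₁ ψa≺ψz) (proj₁ (child-≺ d→z))
      ... | yes ψd≡ψa | _ with inj ψd≡ψa
      ...   | refl = proj₂ ψz≺ψb (cong ψ (branch-unique d→z a→b ψa≺ψz ≼-refl (proj₁ ψz≺ψb)))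
      via-parent {d} d→z | no ψd≢ψa | inj₁ ψa≼ψd =
        ih (child-≺ d→z) (a , b , a→b , (ψa≼ψd , ψd≢ψa ∘ ≡.sym) , ≼-≺-trans (proj₁ (child-≺ d→z)) ψz≺ψb)
      via-parent {d} d→z | no ψd≢ψa | inj₂ ψd≼ψa =
        ih ψa≺ψz (d , z , d→z , (ψd≼ψa , ψd≢ψa) , ψa≺ψz)

  below-inner-vertex : ∀ {a b u y} → Child S root a b → ψ a ≺ u → u ⋖ y → y ≼ ψ b →
                       ∀ z → u ≼ ψ z → y ≼ ψ z
  below-inner-vertex {a} {b} {u} {y} a→b ψa≺u u⋖y y≼ψb =
    Child-inductionˢ (λ z → u ≼ ψ z → y ≼ ψ z) at-root at-child
    where
    u≼ψb : u ≼ ψ b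
    u≼ψb = ≼-trans (⋖⇒≼ u⋖y) y≼ψb

    at-root : u ≼ ψ root → y ≼ ψ root
    at-root u≼ψroot = ⊥-elim (proj₂ (≺-≼-trans ψa≺u (≼-trans u≼ψroot (root-≼-image a))) refl)

    at-child : ∀ {d e} → Child S root d e → (u ≼ ψ d → y ≼ ψ d) → u ≼ ψ e → y ≼ ψ e
    at-child {d} {e} d→e ih u≼ψe with ≼-comparable u≼ψe (proj₁ (child-≺ d→e))
    ... | inj₁ u≼ψd = ≼-trans (ih u≼ψd) (proj₁ (child-≺ d→e))
    ... | inj₂ ψd≼u with ψ d ≟ u
    ...   | yes ψd≡u = ≼-trans (ih (subst (u ≼_) (≡.sym ψd≡u) ≼-refl)) (proj₁ (child-≺ d→e))
    ...   | no ψd≢u with ψ d ≟ ψ a | ≼-comparable (proj₁ ψa≺u) ψd≼u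
    ...     | yes ψd≡ψa | _ with inj ψd≡ψa
    ...       | refl = subst (λ c → y ≼ ψ c) (branch-unique a→b d→e ψa≺u u≼ψb u≼ψe) y≼ψb
    at-child {d} {e} d→e ih u≼ψe | inj₂ ψd≼u | no ψd≢u | no ψd≢ψa | inj₁ ψa≼ψd =
      ⊥-elim (image-not-inside d (a , b , a→b , (ψa≼ψd , ψd≢ψa ∘ ≡.sym) , ≺-≼-trans (ψd≼u , ψd≢u) u≼ψb))
    at-child {d} {e} d→e ih u≼ψe | inj₂ ψd≼u | no ψd≢u | no ψd≢ψa | inj₂ ψd≼ψa =
      ⊥-elim (image-not-inside a (d , e , d→e , (ψd≼ψa , ψd≢ψa) , ≺-≼-trans ψa≺u u≼ψe))

lemma9 : (R : RealField) → let open Weights R in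
    (σ : ℕ) (ω : Fin σ → Fin σ → Ext) (p : Penalty)
    (T T' : LTree σ) (r : V (tree T)) (s : V (tree T'))
    (φ : CSE T T' r s) → IsLaWeCSEu ω p φ →
    (u : V (tree T)) → InnerVertex φ u → ExactlyTwo φ u
lemma9 R σ ω p T T' r s φ _ u (a , b , a→b , ψa⋯u⋯ψb , u≢ψa , u≢ψb) =
  two-branches (≺-parent ψa≺u) (≺-child u≺ψb)
  where
  open Paths (tree T) using (Adj-sym; OnPath-sym)
  open Rooted (tree T) r
  open Embedding (emb φ)

  ψa≺u : ψ φ a ≺ u
  ψa≺u = proj₁ (onPath-≼ (proj₁ (child-≺ a→b)) ψa⋯u⋯ψb) , u≢ψa ∘ ≡.sym

  u≺ψb : u ≺ ψ φ b
  u≺ψb = proj₂ (onPath-≼ (proj₁ (child-≺ a→b)) ψa⋯u⋯ψb) , u≢ψb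

  two-branches : (∃ λ w₁ → w₁ ⋖ u × ψ φ a ≼ w₁) → (∃ λ w₂ → u ⋖ w₂ × w₂ ≼ ψ φ b) → ExactlyTwo φ u
  two-branches (w₁ , w₁⋖u , ψa≼w₁) (w₂ , u⋖w₂ , w₂≼ψb) =
    w₁ , w₂ , Adj-sym (⋖⇒Adj w₁⋖u) , ⋖⇒Adj u⋖w₂ , proj₂ (≺-≼-trans (⋖⇒≺ w₁⋖u) (⋖⇒≼ u⋖w₂)) ,
    (a , OnPath-sym (≼-onPath ψa≼w₁ (⋖⇒≼ w₁⋖u))) , (b , ≼-onPath (⋖⇒≼ u⋖w₂) w₂≼ψb) , only-w₁-w₂
    where
    only-w₁-w₂ : ∀ w → Adj (tree T) u w → Hits φ u w → w ≡ w₁ ⊎ w ≡ w₂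
    only-w₁-w₂ w u-w (c , u⋯ψc) with Adj⇒⋖ u-w
    ... | inj₁ w⋖u = inj₁ (⋖-unique-parent w⋖u w₁⋖u)
    ... | inj₂ u⋖w = inj₂ (⋖-unique-child u⋖w u⋖w₂ w≼ψc w₂≼ψc)
      where
      w≼ψc : w ≼ ψ φ c
      w≼ψc = ⋖-onPath u⋖w u⋯ψc

      w₂≼ψc : w₂ ≼ ψ φ c
      w₂≼ψc = below-inner-vertex a→b ψa≺u u⋖w₂ w₂≼ψb c (≼-trans (⋖⇒≼ u⋖w) w≼ψc)
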